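{- For every integer $n\ge 0$, $$\sum_{j,k}\genfrac{\{}{\}}{0pt}{}{n}{k}\genfrac{[}{]}{0pt}{}{k}{j}\binom{n}{j}(-1)^k=(-1)^n .$$
   Context: Here $\genfrac{[}{]}{0pt}{}{n}{k}$ denotes the unsigned (absolute) Stirling number of the first kind and $\genfrac{\{}{\}}{0pt}{}{n}{k}$ the ordinary Stirling number of the second kind (Knuth's notation), with $\genfrac{[}{]}{0pt}{}{0}{0}=\genfrac{\{}{\}}{0pt}{}{0}{0}=1$, $\genfrac{[}{]}{0pt}{}{n}{0}=\genfrac{\{}{\}}{0pt}{}{n}{0}=0$ for $n>0$, and both vanish for $0\le n<k$. The double summation is over all integers $j,k$ with $0\le j\le k\le n$. -}

module Defs where

open import Data.Nat using (ℕ; zero; suc; _+_; _*_)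
open import Data.Nat.Combinatorics using (_C_)
open import Data.Integer using (ℤ; +_; -_)
import Data.Integer as ℤ

stirling1 : ℕ → ℕ → ℕ
stirling1 zero    zero    = 1
stirling1 zero    (suc k) = 0
stirling1 (suc n) zero    = 0
stirling1 (suc n) (suc k) = n * stirling1 n (suc k) + stirling1 n k

stirling2 : ℕ → ℕ → ℕ
stirling2 zero    zero    = 1
stirling2 zero    (suc k) = 0
stirling2 (suc n) zero    = 0
stirling2 (suc n) (suc k) = suc k * stirling2 n (suc k) + stirling2 n k

signℤ : ℕ → ℤ
signℤ zero    = + 1
signℤ (suc n) = - signℤ n

-- Σ_{i=0}^{n} f i  (inclusive upper bound)
sumTo : ℕ → (ℕ → ℤ) → ℤ
sumTo zero    f = f 0
sumTo (suc n) f = sumTo n f ℤ.+ f (suc n)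

doubleSum : ℕ → ℤ
doubleSum n = sumTo n (λ k → sumTo k (λ j →
  (+ (stirling2 n k * stirling1 k j * (n C j))) ℤ.* signℤ k))

module Submission where

-- Write s(k,j) = (-1)^k [k j] for the signed Stirling numbers of
-- the first kind.  The matrices ({n k}) and (s(k,j)) are inverse to each other
-- up to a sign; precisely the "orthogonality sum"
--     O(n,j) = Σ_k {n k} s(k,j)
-- equals (-1)^n when j = n and 0 when j < n.  Exchanging the order of
-- summation in the theorem turns the double sum into Σ_j C(n,j) O(n,j), of
-- which only the term j = n survives, giving C(n,n) (-1)^n = (-1)^n.

open import Defs
open import Data.Nat using (ℕ; zero; suc; _≤_; _<_; z≤n; s≤s)
import Data.Nat as ℕ
import Data.Nat.Properties as ℕP
open import Data.Nat.Combinatorics using (_C_; nCn≡1)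
open import Data.Integer using (ℤ; +_; -_; _+_; _*_; 0ℤ)
open import Data.Integer.Properties
open import Data.Integer.Solver using (module +-*-Solver)
open +-*-Solver using (solve; _:+_; _:*_; :-_; _:=_)
open import Data.Sum using (inj₁; inj₂)
open import Relation.Binary.PropositionalEquality
open ≡-Reasoning

stirling2-vanish : ∀ n k → n < k → stirling2 n k ≡ 0
stirling2-vanish zero    (suc k) _       = refl
stirling2-vanish (suc n) (suc k) (s≤s p)
  rewrite stirling2-vanish n (suc k) (ℕP.m<n⇒m<1+n p) | stirling2-vanish n k p
  = cong (ℕ._+ 0) (ℕP.*-zeroʳ (suc k))

stirling1-vanish : ∀ n k → n < k → stirling1 n k ≡ 0
stirling1-vanish zero    (suc k) _       = refl
stirling1-vanish (suc n) (suc k) (s≤s p)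
  rewrite stirling1-vanish n (suc k) (ℕP.m<n⇒m<1+n p) | stirling1-vanish n k p
  = cong (ℕ._+ 0) (ℕP.*-zeroʳ n)

sumTo-cong : ∀ n {f g : ℕ → ℤ} → (∀ k → k ≤ n → f k ≡ g k) → sumTo n f ≡ sumTo n g
sumTo-cong zero    h = h 0 z≤n
sumTo-cong (suc n) h =
  cong₂ _+_ (sumTo-cong n (λ k p → h k (ℕP.m≤n⇒m≤1+n p))) (h (suc n) ℕP.≤-refl)

sumTo-+ : ∀ n (f g : ℕ → ℤ) → sumTo n (λ k → f k + g k) ≡ sumTo n f + sumTo n g
sumTo-+ zero    f g = refl
sumTo-+ (suc n) f g rewrite sumTo-+ n f g =
  solve 4 (λ a b c d → (a :+ b) :+ (c :+ d) := (a :+ c) :+ (b :+ d)) refl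
    (sumTo n f) (sumTo n g) (f (suc n)) (g (suc n))

sumTo-scale : ∀ n c (f : ℕ → ℤ) → sumTo n (λ k → c * f k) ≡ c * sumTo n f
sumTo-scale zero    c f = refl
sumTo-scale (suc n) c f rewrite sumTo-scale n c f =
  sym (*-distribˡ-+ c (sumTo n f) (f (suc n)))

sumTo-neg : ∀ n (f : ℕ → ℤ) → sumTo n (λ k → - f k) ≡ - sumTo n f
sumTo-neg n f = begin
  sumTo n (λ k → - f k)         ≡⟨ sumTo-cong n (λ k _ → sym (-1*i≡-i (f k))) ⟩
  sumTo n (λ k → - + 1 * f k)   ≡⟨ sumTo-scale n (- + 1) f ⟩
  - + 1 * sumTo n f             ≡⟨ -1*i≡-i (sumTo n f) ⟩
  - sumTo n f                   ∎

sumTo-zero : ∀ n (f : ℕ → ℤ) → (∀ k → k ≤ n → f k ≡ 0ℤ) → sumTo n f ≡ 0ℤ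
sumTo-zero zero    f h = h 0 z≤n
sumTo-zero (suc n) f h
  rewrite sumTo-zero n f (λ k p → h k (ℕP.m≤n⇒m≤1+n p)) | h (suc n) ℕP.≤-refl = refl

sumTo-last : ∀ n (f : ℕ → ℤ) → (∀ k → k < n → f k ≡ 0ℤ) → sumTo n f ≡ f n
sumTo-last zero    f h = refl
sumTo-last (suc n) f h = begin
  sumTo n f + f (suc n) ≡⟨ cong (_+ f (suc n)) (sumTo-zero n f (λ k p → h k (s≤s p))) ⟩
  0ℤ + f (suc n)        ≡⟨ +-identityˡ (f (suc n)) ⟩
  f (suc n)             ∎

sumTo-shift : ∀ n (f : ℕ → ℤ) → sumTo (suc n) f ≡ f 0 + sumTo n (λ k → f (suc k))
sumTo-shift zero    f = refl
sumTo-shift (suc n) f rewrite sumTo-shift n f = +-assoc (f 0) _ _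

sumTo-extend : ∀ m n (f : ℕ → ℤ) → m ≤ n → (∀ k → m < k → f k ≡ 0ℤ) →
               sumTo m f ≡ sumTo n f
sumTo-extend m zero    f z≤n h = refl
sumTo-extend m (suc n) f p   h with ℕP.m≤n⇒m<n∨m≡n p
... | inj₂ refl = refl
... | inj₁ (s≤s q) rewrite h (suc n) (s≤s q) =
  trans (sumTo-extend m n f q h) (sym (+-identityʳ _))

sumTo-swap : ∀ n m (a : ℕ → ℕ → ℤ) →
             sumTo n (λ k → sumTo m (λ j → a k j)) ≡ sumTo m (λ j → sumTo n (λ k → a k j))
sumTo-swap zero    m a = refl
sumTo-swap (suc n) m a rewrite sumTo-swap n m a =
  sym (sumTo-+ m (λ j → sumTo n (λ k → a k j)) (λ j → a (suc n) j))

-- The Stirling-2 transform of any sequence g satisfies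
--   Σ_k {n+1 k} g(k) = Σ_k {n k} (k g(k) + g(k+1)),
-- obtained from {n+1 k+1} = (k+1){n k+1} + {n k} by re-indexing.
stirling2-transform-suc : ∀ n (g : ℕ → ℤ) →
  sumTo (suc n) (λ k → + stirling2 (suc n) k * g k)
    ≡ sumTo n (λ k → + stirling2 n k * (+ k * g k + g (suc k)))
stirling2-transform-suc n g = begin
  sumTo (suc n) (λ k → + stirling2 (suc n) k * g k)
    ≡⟨ sumTo-shift n _ ⟩
  0ℤ + sumTo n (λ k → + stirling2 (suc n) (suc k) * g (suc k))
    ≡⟨ +-identityˡ _ ⟩
  sumTo n (λ k → + stirling2 (suc n) (suc k) * g (suc k))
    ≡⟨ sumTo-cong n (λ k _ → split k) ⟩
  sumTo n (λ k → weighted (suc k) + lowered k)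
    ≡⟨ sumTo-+ n (λ k → weighted (suc k)) lowered ⟩
  sumTo n (λ k → weighted (suc k)) + sumTo n lowered
    ≡⟨ cong (_+ sumTo n lowered) weighted-reindex ⟩
  sumTo n weighted + sumTo n lowered
    ≡⟨ sym (sumTo-+ n weighted lowered) ⟩
  sumTo n (λ k → weighted k + lowered k)
    ≡⟨ sumTo-cong n (λ k _ → regroup k) ⟩
  sumTo n (λ k → + stirling2 n k * (+ k * g k + g (suc k))) ∎
  where
  -- k {n k} g(k): vanishes at k = 0 (factor k) and at k = n+1 (above the diagonal)
  weighted : ℕ → ℤ
  weighted k = + k * + stirling2 n k * g k
  lowered : ℕ → ℤ
  lowered k = + stirling2 n k * g (suc k)

  split : ∀ k → + stirling2 (suc n) (suc k) * g (suc k) ≡ weighted (suc k) + lowered k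
  split k = begin
    + (suc k ℕ.* stirling2 n (suc k) ℕ.+ stirling2 n k) * g (suc k)
      ≡⟨ cong (_* g (suc k)) (trans (pos-+ (suc k ℕ.* stirling2 n (suc k)) _)
                                    (cong (_+ + stirling2 n k) (pos-* (suc k) _))) ⟩
    (+ suc k * + stirling2 n (suc k) + + stirling2 n k) * g (suc k)
      ≡⟨ *-distribʳ-+ (g (suc k)) (+ suc k * + stirling2 n (suc k)) (+ stirling2 n k) ⟩
    weighted (suc k) + lowered k ∎

  weighted-top : weighted (suc n) ≡ 0ℤ
  weighted-top rewrite stirling2-vanish n (suc n) ℕP.≤-refl =
    cong (_* g (suc n)) (*-zeroʳ (+ suc n))

  weighted-reindex : sumTo n (λ k → weighted (suc k)) ≡ sumTo n weighted
  weighted-reindex = begin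
    sumTo n (λ k → weighted (suc k))        ≡⟨ sym (+-identityˡ _) ⟩
    0ℤ + sumTo n (λ k → weighted (suc k))   ≡⟨ sym (sumTo-shift n weighted) ⟩
    sumTo n weighted + weighted (suc n)     ≡⟨ cong (λ z → sumTo n weighted + z) weighted-top ⟩
    sumTo n weighted + 0ℤ                   ≡⟨ +-identityʳ _ ⟩
    sumTo n weighted                        ∎

  regroup : ∀ k → weighted k + lowered k ≡ + stirling2 n k * (+ k * g k + g (suc k))
  regroup k = solve 4 (λ a b c d → a :* b :* c :+ b :* d := b :* (a :* c :+ d)) refl
    (+ k) (+ stirling2 n k) (g k) (g (suc k))

signedStirling1 : ℕ → ℕ → ℤ
signedStirling1 k j = + stirling1 k j * signℤ k

signedStirling1-rec-zero : ∀ k → + k * signedStirling1 k 0 + signedStirling1 (suc k) 0 ≡ 0ℤ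
signedStirling1-rec-zero zero    = refl
signedStirling1-rec-zero (suc k) = cong (_+ 0ℤ) (*-zeroʳ (+ suc k))

signedStirling1-rec-suc : ∀ k i →
  + k * signedStirling1 k (suc i) + signedStirling1 (suc k) (suc i) ≡ - signedStirling1 k i
signedStirling1-rec-suc k i = begin
  + k * (+ stirling1 k (suc i) * signℤ k)
    + + (k ℕ.* stirling1 k (suc i) ℕ.+ stirling1 k i) * (- signℤ k)
    ≡⟨ cong (λ z → + k * (+ stirling1 k (suc i) * signℤ k) + z * (- signℤ k))
         (trans (pos-+ (k ℕ.* stirling1 k (suc i)) (stirling1 k i))
                (cong (_+ + stirling1 k i) (pos-* k (stirling1 k (suc i))))) ⟩
  + k * (+ stirling1 k (suc i) * signℤ k)
    + (+ k * + stirling1 k (suc i) + + stirling1 k i) * (- signℤ k)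
    ≡⟨ solve 4 (λ a b c s → a :* (b :* s) :+ (a :* b :+ c) :* (:- s) := :- (c :* s)) refl
         (+ k) (+ stirling1 k (suc i)) (+ stirling1 k i) (signℤ k) ⟩
  - (+ stirling1 k i * signℤ k) ∎

orthogonality : ℕ → ℕ → ℤ
orthogonality n j = sumTo n (λ k → + stirling2 n k * signedStirling1 k j)

orthogonality-suc-zero : ∀ n → orthogonality (suc n) 0 ≡ 0ℤ
orthogonality-suc-zero n = begin
  orthogonality (suc n) 0
    ≡⟨ stirling2-transform-suc n (λ k → signedStirling1 k 0) ⟩
  sumTo n (λ k → + stirling2 n k * (+ k * signedStirling1 k 0 + signedStirling1 (suc k) 0))
    ≡⟨ sumTo-zero n _ (λ k _ → trans (cong (+ stirling2 n k *_) (signedStirling1-rec-zero k))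
                                      (*-zeroʳ (+ stirling2 n k))) ⟩
  0ℤ ∎

orthogonality-suc-suc : ∀ n i → orthogonality (suc n) (suc i) ≡ - orthogonality n i
orthogonality-suc-suc n i = begin
  orthogonality (suc n) (suc i)
    ≡⟨ stirling2-transform-suc n (λ k → signedStirling1 k (suc i)) ⟩
  sumTo n (λ k → + stirling2 n k
                 * (+ k * signedStirling1 k (suc i) + signedStirling1 (suc k) (suc i)))
    ≡⟨ sumTo-cong n (λ k _ → trans (cong (+ stirling2 n k *_) (signedStirling1-rec-suc k i))
                                   (sym (neg-distribʳ-* (+ stirling2 n k) _))) ⟩
  sumTo n (λ k → - (+ stirling2 n k * signedStirling1 k i))
    ≡⟨ sumTo-neg n _ ⟩
  - orthogonality n i ∎

orthogonality-diagonal : ∀ n → orthogonality n n ≡ signℤ n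
orthogonality-diagonal zero    = refl
orthogonality-diagonal (suc n) =
  trans (orthogonality-suc-suc n n) (cong -_ (orthogonality-diagonal n))

orthogonality-below : ∀ n j → j < n → orthogonality n j ≡ 0ℤ
orthogonality-below (suc n) zero    _       = orthogonality-suc-zero n
orthogonality-below (suc n) (suc j) (s≤s p) =
  trans (orthogonality-suc-suc n j) (cong -_ (orthogonality-below n j p))

summand : ℕ → ℕ → ℕ → ℤ
summand n k j = + (stirling2 n k ℕ.* stirling1 k j ℕ.* (n C j)) * signℤ k

-- It vanishes for j > k, so the inner sum may run up to n.
summand-vanish : ∀ n k j → k < j → summand n k j ≡ 0ℤ
summand-vanish n k j q rewrite stirling1-vanish k j q | ℕP.*-zeroʳ (stirling2 n k) = refl

-- It factors as C(n,j) · {n k} s(k,j), exposing the orthogonality sum.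
summand-factor : ∀ n k j → summand n k j ≡ + (n C j) * (+ stirling2 n k * signedStirling1 k j)
summand-factor n k j = begin
  + (stirling2 n k ℕ.* stirling1 k j ℕ.* (n C j)) * signℤ k
    ≡⟨ cong (_* signℤ k) (trans (pos-* (stirling2 n k ℕ.* stirling1 k j) (n C j))
                                (cong (_* + (n C j)) (pos-* (stirling2 n k) (stirling1 k j)))) ⟩
  + stirling2 n k * + stirling1 k j * + (n C j) * signℤ k
    ≡⟨ solve 4 (λ x y c s → x :* y :* c :* s := c :* (x :* (y :* s))) refl
         (+ stirling2 n k) (+ stirling1 k j) (+ (n C j)) (signℤ k) ⟩
  + (n C j) * (+ stirling2 n k * signedStirling1 k j) ∎

mainTheorem3 : (n : ℕ) → doubleSum n ≡ signℤ n
mainTheorem3 n = begin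
  doubleSum n
    ≡⟨ sumTo-cong n (λ k k≤n → sumTo-extend k n (summand n k) k≤n (summand-vanish n k)) ⟩
  sumTo n (λ k → sumTo n (λ j → summand n k j))
    ≡⟨ sumTo-swap n n (summand n) ⟩
  sumTo n (λ j → sumTo n (λ k → summand n k j))
    ≡⟨ sumTo-cong n (λ j _ → trans (sumTo-cong n (λ k _ → summand-factor n k j))
                                   (sumTo-scale n (+ (n C j)) _)) ⟩
  sumTo n (λ j → + (n C j) * orthogonality n j)
    ≡⟨ sumTo-last n _ (λ j j<n → trans (cong (+ (n C j) *_) (orthogonality-below n j j<n))
                                       (*-zeroʳ (+ (n C j)))) ⟩
  + (n C n) * orthogonality n n
    ≡⟨ cong₂ _*_ (cong +_ (nCn≡1 n)) (orthogonality-diagonal n) ⟩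
  + 1 * signℤ n
    ≡⟨ *-identityˡ (signℤ n) ⟩
  signℤ n ∎
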